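{- For every integer $n>0$, we have $M_n \geq_{\mathcal{E}} M_{n+1}$, where $M_n$ denotes the perfect murder of rank $n$.
   Context: All games are short (finite) two-player partizan games between Left and Right, identified with their game trees: a game is $G=\{G^{\mathcal L}\mid G^{\mathcal R}\}$, where $G^{\mathcal L}$ and $G^{\mathcal R}$ are finite sets of games (the Left and Right options). The followers of $G$ are $G$ itself, its options, their options, and so on. $\mathbf 0=\{\;\mid\;\}$. The disjunctive sum is $G+H=\{G^{\mathcal L}+H,\,G+H^{\mathcal L}\mid G^{\mathcal R}+H,\,G+H^{\mathcal R}\}$. Play is misère: a player who has no move on their turn wins. The Left-outcome is $o_L(G)=\mathrm L$ if $G^{\mathcal L}=\emptyset$ and otherwise $\max_{G^L} o_R(G^L)$; the Right-outcome is $o_R(G)=\mathrm R$ if $G^{\mathcal R}=\emptyset$ and otherwise $\min_{G^R} o_L(G^R)$, with $\mathrm L>\mathrm R$. The outcome $o(G)$ is $\mathscr L,\mathscr N,\mathscr P,\mathscr R$ according as $(o_L(G),o_R(G))$ is $(\mathrm L,\mathrm L),(\mathrm L,\mathrm R),(\mathrm R,\mathrm L),(\mathrm R,\mathrm R)$; outcomes are partially ordered componentwise, i.e. $\mathscr L>\mathscr N>\mathscr R$, $\mathscr L>\mathscr P>\mathscr R$, with $\mathscr N,\mathscr P$ incomparable. A game is a Left-end if it has no Left option; a dead Left-end if every follower is a Left-end; similarly for Right. A game is dead-ending if every follower that is a Left-end is a dead Left-end and every follower that is a Right-end is a dead Right-end. $\mathcal E$ is the class of all dead-ending games. For games $G,H$,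 $G\geq_{\mathcal E}H$ means $o(G+X)\geq o(H+X)$ for all $X\in\mathcal E$. The perfect murders are defined by $M_0=\mathbf 0$ and $M_n=\{\;\mid \mathbf 0, M_{n-1}\}$ for $n>0$ (so $M_n$ has no Left options and Right options $\mathbf 0$ and $M_{n-1}$). -}

module Defs where

open import Data.Nat using (ℕ; zero; suc)
open import Data.List using (List; []; _∷_; _++_)
open import Data.List.Membership.Propositional using (_∈_)
open import Data.Product using (_×_)
open import Relation.Binary.PropositionalEquality using (_≡_)

-- A short partizan game, identified with its game tree:
-- mk GL GR has Left options GL and Right options GR (finite, as lists).
data Game : Set where
  mk : List Game → List Game → Game

leftOpts : Game → List Game
leftOpts (mk gl _) = gl

rightOpts : Game → List Game
rightOpts (mk _ gr) = gr

𝟘 : Game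
𝟘 = mk [] []

mutual
  infixl 6 _⊕_
  _⊕_ : Game → Game → Game
  G@(mk gl gr) ⊕ H@(mk hl hr) = mk (sumL gl H ++ sumR G hl) (sumL gr H ++ sumR G hr)

  sumL : List Game → Game → List Game
  sumL [] H = []
  sumL (g ∷ gs) H = (g ⊕ H) ∷ sumL gs H

  sumR : Game → List Game → List Game
  sumR G [] = []
  sumR G (h ∷ hs) = (G ⊕ h) ∷ sumR G hs

-- Results, with L > R
data Result : Set where
  L R : Result

_⊔ʳ_ : Result → Result → Result
L ⊔ʳ _ = L
R ⊔ʳ r = r

_⊓ʳ_ : Result → Result → Result
R ⊓ʳ _ = R
L ⊓ʳ r = r

-- Misère outcomes: a player with no move on their turn wins.
mutual
  oL : Game → Result
  oL (mk [] _) = L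
  oL (mk (g ∷ gs) _) = maxR g gs

  oR : Game → Result
  oR (mk _ []) = R
  oR (mk _ (g ∷ gs)) = minL g gs

  maxR : Game → List Game → Result
  maxR g [] = oR g
  maxR g (h ∷ hs) = oR g ⊔ʳ maxR h hs

  minL : Game → List Game → Result
  minL g [] = oL g
  minL g (h ∷ hs) = oL g ⊓ʳ minL h hs

data _≥ʳ_ : Result → Result → Set where
  L≥ : ∀ {r} → L ≥ʳ r
  R≥R : R ≥ʳ R

record Outcome : Set where
  constructor ⟨_,_⟩
  field
    left  : Result
    right : Result

o : Game → Outcome
o G = ⟨ oL G , oR G ⟩

_≥ᵒ_ : Outcome → Outcome → Set
⟨ a , b ⟩ ≥ᵒ ⟨ c , d ⟩ = (a ≥ʳ c) × (b ≥ʳ d)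

data Follower : Game → Game → Set where
  self  : ∀ {G} → Follower G G
  viaL  : ∀ {G G' H} → G' ∈ leftOpts G → Follower H G' → Follower H G
  viaR  : ∀ {G G' H} → G' ∈ rightOpts G → Follower H G' → Follower H G

IsLeftEnd : Game → Set
IsLeftEnd G = leftOpts G ≡ []

IsRightEnd : Game → Set
IsRightEnd G = rightOpts G ≡ []

DeadLeftEnd : Game → Set
DeadLeftEnd G = ∀ H → Follower H G → IsLeftEnd H

DeadRightEnd : Game → Set
DeadRightEnd G = ∀ H → Follower H G → IsRightEnd H

DeadEnding : Game → Set
DeadEnding G = ∀ H → Follower H G →
  (IsLeftEnd H → DeadLeftEnd H) × (IsRightEnd H → DeadRightEnd H)

_≥𝓔_ : Game → Game → Set
G ≥𝓔 H = ∀ X → DeadEnding X → o (G ⊕ X) ≥ᵒ o (H ⊕ X)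

M : ℕ → Game
M zero = 𝟘
M (suc n) = mk [] (𝟘 ∷ M n ∷ [])

module Submission where

-- We prove more than the dead-ending statement: the comparison holds in
-- every context X, dead-ending or not.  Write G ≼ H when, for every X,
-- Left winning G + X (moving first, resp. second) implies Left winning
-- H + X.  The general fact behind the theorem is a domination criterion
-- for Left-ends: if G = { | Gᴿ } and H = { | Hᴿ } with Hᴿ nonempty, and
-- every Hᴿ is at least as good for Left (moving first) as some Gᴿ in all
-- contexts, then G ≼ H.  Its proof is an induction on the context X,
-- after characterising misère outcomes of a sum through its options.
-- For the murders, M (n+2) = { | 0, M (n+1) } and M (n+1) = { | 0, M n };
-- the option 0 dominates itself and M n is handled by induction on n
-- (with M 0 = 0 in the base case), so M (n+2) ≼ M (n+1).  Finally ≼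
-- implies the outcome order in all contexts, in particular in 𝓔.

open import Defs
open import Data.Nat using (ℕ; zero; suc; _>_; s≤s)
open import Data.List using (List; []; _∷_; _++_)
open import Data.List.Membership.Propositional using (_∈_)
open import Data.List.Membership.Propositional.Properties using (∈-++⁺ˡ; ∈-++⁺ʳ; ∈-++⁻)
open import Data.List.Relation.Unary.All using (All; []; _∷_; lookup)
open import Data.List.Relation.Unary.Any using (here; there)
open import Data.Product using (Σ; _×_; _,_; proj₁; proj₂)
open import Data.Sum using (inj₁; inj₂)
open import Relation.Binary.PropositionalEquality using (_≡_; refl)

∈-sumL : ∀ {g gs} X → g ∈ gs → (g ⊕ X) ∈ sumL gs X
∈-sumL X (here refl) = here refl
∈-sumL X (there p)   = there (∈-sumL X p)

sumL-∈ : ∀ {y} gs X → y ∈ sumL gs X → Σ Game λ g → g ∈ gs × y ≡ g ⊕ X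
sumL-∈ (g ∷ gs) X (here p)  = g , here refl , p
sumL-∈ (g ∷ gs) X (there p) with sumL-∈ gs X p
... | g′ , g′∈gs , y≡ = g′ , there g′∈gs , y≡

∈-sumR : ∀ {x xs} G → x ∈ xs → (G ⊕ x) ∈ sumR G xs
∈-sumR G (here refl) = here refl
∈-sumR G (there p)   = there (∈-sumR G p)

sumR-∈ : ∀ {y} G xs → y ∈ sumR G xs → Σ Game λ x → x ∈ xs × y ≡ G ⊕ x
sumR-∈ G (x ∷ xs) (here p)  = x , here refl , p
sumR-∈ G (x ∷ xs) (there p) with sumR-∈ G xs p
... | x′ , x′∈xs , y≡ = x′ , there x′∈xs , y≡

maxR-wins : ∀ g gs → maxR g gs ≡ L → Σ Game λ y → y ∈ (g ∷ gs) × oR y ≡ L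
maxR-wins g []       e = g , here refl , e
maxR-wins g (h ∷ hs) e with oR g in eq
... | L = g , here refl , eq
... | R with maxR-wins h hs e
...   | y , y∈ , ey = y , there y∈ , ey

wins-maxR : ∀ g gs {y} → y ∈ (g ∷ gs) → oR y ≡ L → maxR g gs ≡ L
wins-maxR g []       (here refl) e = e
wins-maxR g (h ∷ hs) (here refl) e rewrite e = refl
wins-maxR g (h ∷ hs) (there p)   e with oR g
... | L = refl
... | R = wins-maxR h hs p e

minL-wins : ∀ g gs → minL g gs ≡ L → ∀ {y} → y ∈ (g ∷ gs) → oL y ≡ L
minL-wins g []       e (here refl) = e
minL-wins g (h ∷ hs) e y∈ with oL g in eq
minL-wins g (h ∷ hs) () y∈          | R
minL-wins g (h ∷ hs) e  (here refl) | L = eq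
minL-wins g (h ∷ hs) e  (there y∈)  | L = minL-wins h hs e y∈

wins-minL : ∀ g gs → (∀ {y} → y ∈ (g ∷ gs) → oL y ≡ L) → minL g gs ≡ L
wins-minL g []       f = f (here refl)
wins-minL g (h ∷ hs) f rewrite f (here refl) = wins-minL h hs (λ y∈ → f (there y∈))

oR-wins : ∀ l rs → oR (mk l rs) ≡ L → ∀ {y} → y ∈ rs → oL y ≡ L
oR-wins l (g ∷ gs) e = minL-wins g gs e

LeftFirstBetter LeftSecondBetter : Game → Game → Game → Set
LeftFirstBetter  G H X = oL (G ⊕ X) ≡ L → oL (H ⊕ X) ≡ L
LeftSecondBetter G H X = oR (G ⊕ X) ≡ L → oR (H ⊕ X) ≡ L

Better : Game → Game → Game → Set
Better G H X = LeftFirstBetter G H X × LeftSecondBetter G H X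

_≼_ : Game → Game → Set
G ≼ H = ∀ X → Better G H X

Dominated : List Game → List Game → Set
Dominated gs hs = ∀ {h} → h ∈ hs →
  Σ Game λ g → g ∈ gs × (∀ X → LeftFirstBetter g h X)

-- The domination criterion for Left-ends, proved by induction on X.  The
-- nonemptiness of H's Right options is needed when X has no Right move.
module LeftEndDomination {gr h hs} (dom : Dominated gr (h ∷ hs)) where

  G H : Game
  G = mk [] gr
  H = mk [] (h ∷ hs)

  -- Left's only moves are in X; copy Left's winning move there.
  leftFirst : ∀ xl xr → All (Better G H) xl → LeftFirstBetter G H (mk xl xr)
  leftFirst []       xr _  _ = refl
  leftFirst (x ∷ xs) xr ih e with maxR-wins (G ⊕ x) (sumR G xs) e
  ... | y , y∈ , ey with sumR-∈ G (x ∷ xs) y∈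
  ...   | x′ , x′∈ , refl =
    wins-maxR (H ⊕ x) (sumR H xs) (∈-sumR H x′∈) (proj₂ (lookup ih x′∈) ey)

  -- Each Right move in H + X answers some Right move in G + X that Left
  -- wins: a move in H is dominated, a move in X is handled inductively.
  rightFirst : ∀ xl xr → All (Better G H) xr → LeftSecondBetter G H (mk xl xr)
  rightFirst xl xr ih e = wins-minL (h ⊕ X) (sumL hs X ++ sumR H xr) answer
    where
    X = mk xl xr

    winsG : ∀ {y} → y ∈ sumL gr X ++ sumR G xr → oL y ≡ L
    winsG = oR-wins (sumR G xl) (sumL gr X ++ sumR G xr) e

    answer : ∀ {y} → y ∈ sumL (h ∷ hs) X ++ sumR H xr → oL y ≡ L
    answer y∈ with ∈-++⁻ (sumL (h ∷ hs) X) y∈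
    ... | inj₁ inH with sumL-∈ (h ∷ hs) X inH
    ...   | h′ , h′∈ , refl with dom h′∈
    ...     | g , g∈ , better = better X (winsG (∈-++⁺ˡ (∈-sumL X g∈)))
    answer y∈ | inj₂ inX with sumR-∈ H xr inX
    ...   | x , x∈ , refl =
      proj₁ (lookup ih x∈) (winsG (∈-++⁺ʳ (sumL gr X) (∈-sumR G x∈)))

  mutual
    better : G ≼ H
    better (mk xl xr) = leftFirst xl xr (betterAll xl) , rightFirst xl xr (betterAll xr)

    betterAll : ∀ xs → All (Better G H) xs
    betterAll []       = []
    betterAll (x ∷ xs) = better x ∷ betterAll xs

leftEnd-≼ : ∀ {gr h hs} → Dominated gr (h ∷ hs) → mk [] gr ≼ mk [] (h ∷ hs)
leftEnd-≼ dom = LeftEndDomination.better dom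

-- The Right
-- options of M (n+1) are 0 and M n; they are dominated by the options
-- 0 and M (n+1) of M (n+2) (for n = 0, M 0 = 0 is dominated by 0).
murder-≼ : ∀ n → M (suc (suc n)) ≼ M (suc n)
murder-≼ zero = leftEnd-≼ dominated
  where
  dominated : Dominated (𝟘 ∷ M 1 ∷ []) (𝟘 ∷ 𝟘 ∷ [])
  dominated (here refl)         = 𝟘 , here refl , λ X win → win
  dominated (there (here refl)) = 𝟘 , here refl , λ X win → win
murder-≼ (suc n) = leftEnd-≼ dominated
  where
  dominated : Dominated (𝟘 ∷ M (suc (suc n)) ∷ []) (𝟘 ∷ M (suc n) ∷ [])
  dominated (here refl)         = 𝟘 , here refl , λ X win → win
  dominated (there (here refl)) =
    M (suc (suc n)) , there (here refl) , λ X → proj₁ (murder-≼ n X)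

wins⇒≥ʳ : ∀ a b → (b ≡ L → a ≡ L) → a ≥ʳ b
wins⇒≥ʳ L b _ = L≥
wins⇒≥ʳ R L f with f refl
... | ()
wins⇒≥ʳ R R _ = R≥R

≼⇒≥𝓔 : ∀ {G H} → G ≼ H → H ≥𝓔 G
≼⇒≥𝓔 G≼H X _ = wins⇒≥ʳ _ _ (proj₁ (G≼H X)) , wins⇒≥ʳ _ _ (proj₂ (G≼H X))

mainTheorem1 : ∀ (n : ℕ) → n > 0 → M n ≥𝓔 M (suc n)
mainTheorem1 (suc n) (s≤s _) = ≼⇒≥𝓔 {M (suc (suc n))} {M (suc n)} (murder-≼ n)
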